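{- Let $p,h,k$ be positive integers, $\beta\in I_{(h,k)}$ and $\rho\in\mathcal P_{(p,h,k),\beta}$. Then the Bar Code $\mathcal B_\rho$ determined by $\rho$ is admissible; equivalently, the set $\mathsf N_\rho=\{x_1^{a}x_2^{j-1}x_3^{i-1} : 1\le i\le k,\ 1\le j\le\beta_i,\ 0\le a\le\rho_{i,j}-1\}$ is an order ideal of terms of $\mathbf k[x_1,x_2,x_3]$.
   Context: $I_{(h,k)}$ is the set of $(\beta_1,\dots,\beta_k)\in\mathbb N^k$ with $\beta_1>\dots>\beta_k>0$ and $\sum\beta_i=h$. For $\beta\in I_{(h,k)}$, $\mathcal P_{(p,h,k),\beta}$ is the set of arrays $\rho=(\rho_{i,j})_{1\le i\le k,\,1\le j\le\beta_i}$ of integers (a row- and column-strict plane partition of shape $\beta$) with: $\rho_{i,j}>0$; $\rho_{i,j}>\rho_{i,j+1}$ for $1\le j\le\beta_i-1$; $\rho_{i,j}>\rho_{i+1,j}$ for $1\le i\le k-1$, $1\le j\le\beta_{i+1}$; and $\sum_{i,j}\rho_{i,j}=p$. The Bar Code $\mathcal B_\rho$ has $k$ bars in row 3; over the $i$-th 3-bar lie $\beta_i$ 2-bars, and over the $j$-th 2-bar above the $i$-th 3-bar lie $\rho_{i,j}$ 1-bars (each a single column). For an abstract Bar Code (rows of interval partitions of the columns, row 1 singletons, each row refining the next), the e-list of a column $c$ is $(b_1,b_2,b_3)$ where $b_3$ is the number of 3-bars left of the one containing $c$, and $b_i$ ($i=1,2$) is the number of $i$-bars inside the $(i+1)$-bar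 containing $c$ and to the left of the $i$-bar containing $c$; the Bar Code is admissible if $\{x_1^{b_1}x_2^{b_2}x_3^{b_3}\}$ over all columns is an order ideal (closed under divisors). For $\mathcal B_\rho$ this set is $\mathsf N_\rho$. -}

module Defs where

open import Data.Nat using (ℕ; zero; suc; _+_; _<_; _≤_)
open import Data.Product using (_×_)
open import Relation.Binary.PropositionalEquality using (_≡_)

-- Indices are 0-based: row i ∈ {0,…,k-1} stands for the paper's i+1,
-- column j ∈ {0,…,β i - 1} stands for the paper's j+1.

sumTo : ℕ → (ℕ → ℕ) → ℕ
sumTo zero    f = 0
sumTo (suc n) f = sumTo n f + f n

InI : ℕ → ℕ → (ℕ → ℕ) → Set
InI h k β =
  (∀ i → suc i < k → β (suc i) < β i) ×
  (∀ i → i < k → 0 < β i) ×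
  (sumTo k β ≡ h)

InP : ℕ → ℕ → ℕ → (ℕ → ℕ) → (ℕ → ℕ → ℕ) → Set
InP p h k β ρ =
  (∀ i j → i < k → j < β i → 0 < ρ i j) ×
  (∀ i j → i < k → suc j < β i → ρ i (suc j) < ρ i j) ×
  (∀ i j → suc i < k → j < β (suc i) → ρ (suc i) j < ρ i j) ×
  (sumTo k (λ i → sumTo (β i) (ρ i)) ≡ p)

-- A term x1^a x2^b x3^c of k[x1,x2,x3] is represented by its exponent triple.
Term : Set
Term = ℕ × ℕ × ℕ

_∣ₜ_ : Term → Term → Set
(a' Data.Product., b' Data.Product., c') ∣ₜ (a Data.Product., b Data.Product., c) =
  (a' ≤ a) × (b' ≤ b) × (c' ≤ c)

IsOrderIdeal : (Term → Set) → Set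
IsOrderIdeal S = ∀ t t' → S t → t' ∣ₜ t → S t'

-- N_ρ = { x1^a x2^(j-1) x3^(i-1) : 1≤i≤k, 1≤j≤β_i, 0≤a≤ρ_{i,j}-1 }
-- (with 0-based i, j: exponent of x2 is j, of x3 is i)
Nρ : ℕ → (ℕ → ℕ) → (ℕ → ℕ → ℕ) → Term → Set
Nρ k β ρ (a Data.Product., j Data.Product., i) = (i < k) × (j < β i) × (a < ρ i j)

module Submission where

open import Defs
open import Data.Nat using (ℕ; suc; _<_; _≤_; _≤′_; ≤′-refl; ≤′-step)
open import Data.Nat.Properties
  using (≤-refl; ≤-trans; <⇒≤; <-trans; ≤-<-trans; <-≤-trans; ≤⇒≤′)
open import Data.Product using (_,_; _×_; proj₁; proj₂)

-- Strict decrease along rows and columns makes ρ antitone in each index, and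
-- β antitone in i; so lowering i, then j, then a stays inside N_ρ.

antitone-on : (f : ℕ → ℕ) (P : ℕ → Set) →
  (∀ m → P (suc m) → f (suc m) ≤ f m) →
  (∀ m → P (suc m) → P m) →
  ∀ {i' i} → i' ≤′ i → P i → f i ≤ f i'
antitone-on f P step down ≤′-refl        Pi = ≤-refl
antitone-on f P step down (≤′-step i'≤i) Pi =
  ≤-trans (step _ Pi) (antitone-on f P step down i'≤i (down _ Pi))

module _ {h k : ℕ} {β : ℕ → ℕ} (β∈I : InI h k β) where

  private
    β-dec = proj₁ β∈I

  β-antitone : ∀ {i' i} → i' ≤ i → i < k → β i ≤ β i'
  β-antitone i'≤i =
    antitone-on β (_< k) (λ m sm<k → <⇒≤ (β-dec m sm<k)) (λ _ → <⇒≤) (≤⇒≤′ i'≤i)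

  module _ {p : ℕ} {ρ : ℕ → ℕ → ℕ} (ρ∈P : InP p h k β ρ) where

    private
      row-dec = proj₁ (proj₂ ρ∈P)
      col-dec = proj₁ (proj₂ (proj₂ ρ∈P))

    ρ-antitone-down : ∀ {i' i j} → i' ≤ i → i < k → j < β i → ρ i j ≤ ρ i' j
    ρ-antitone-down {j = j} i'≤i i<k j<βi =
      antitone-on (λ m → ρ m j) (λ m → m < k × j < β m)
        (λ m (sm<k , j<βsm) → <⇒≤ (col-dec m j sm<k j<βsm))
        (λ m (sm<k , j<βsm) → <⇒≤ sm<k , <-trans j<βsm (β-dec m sm<k))
        (≤⇒≤′ i'≤i) (i<k , j<βi)

    ρ-antitone-across : ∀ {i j' j} → i < k → j' ≤ j → j < β i → ρ i j ≤ ρ i j'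
    ρ-antitone-across {i} i<k j'≤j =
      antitone-on (ρ i) (_< β i) (λ m sm<βi → <⇒≤ (row-dec i m i<k sm<βi))
        (λ _ → <⇒≤) (≤⇒≤′ j'≤j)

mainTheorem10 : (p h k : ℕ) → 0 < p → 0 < h → 0 < k →
    (β : ℕ → ℕ) → InI h k β →
    (ρ : ℕ → ℕ → ℕ) → InP p h k β ρ →
    IsOrderIdeal (Nρ k β ρ)
mainTheorem10 p h k _ _ _ β β∈I ρ ρ∈P
  (a , j , i) (a' , j' , i') (i<k , j<βi , a<ρij) (a'≤a , j'≤j , i'≤i) =
  i'<k , j'<βi' , <-≤-trans (≤-<-trans a'≤a a<ρij) ρij≤ρi'j'
  where
  i'<k : i' < k
  i'<k = ≤-<-trans i'≤i i<k

  j<βi' : j < β i'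
  j<βi' = <-≤-trans j<βi (β-antitone β∈I i'≤i i<k)

  j'<βi' : j' < β i'
  j'<βi' = ≤-<-trans j'≤j j<βi'

  ρij≤ρi'j' : ρ i j ≤ ρ i' j'
  ρij≤ρi'j' = ≤-trans (ρ-antitone-down β∈I ρ∈P i'≤i i<k j<βi)
                      (ρ-antitone-across β∈I ρ∈P i'<k j'≤j j<βi')
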